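{- Let $n\in\mathbb{Z}_{\geq1}$. For all $\sigma_1,\sigma_2\in\mathcal{S}_{[n]}$, \[ C_{\mathrm{B},2,n}\Bigl(\tfrac12\bigl(P_{\sigma_1}+P_{\sigma_2}\bigr)\Bigr)=1. \]
   Context: $\mathcal{S}_{[n]}$ is the set of permutations of $[n]$; $P_\sigma$ is the $n\times n$ permutation matrix with $P_\sigma(i,j)=1$ iff $\sigma(i)=j$. For an $n\times n$ doubly stochastic matrix $\gamma$ with entries that are integer multiples of $1/2$, $C_{\mathrm{B},2,n}(\gamma)=(2!)^{2n-n^2}\prod_{i,j\in[n]}\frac{(2-2\gamma(i,j))!}{(2\gamma(i,j))!}$. -}

module Defs where

open import Data.Nat as ℕ using (ℕ; zero; suc; _∸_; NonZero)
open import Data.Nat.Properties using (_!≢0; m^n≢0)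
open import Data.Nat using (_!)
open import Data.Integer as ℤ using (ℤ; +_; -[1+_])
open import Data.Rational as ℚ using (ℚ; 1ℚ; _*_; _/_)
open import Data.Fin using (Fin; zero; suc)
open import Data.Fin.Permutation using (Permutation′; _⟨$⟩ʳ_)
open import Data.Fin.Properties using (_≟_)
open import Relation.Nullary.Decidable using (does)
open import Data.Bool using (if_then_else_)

∏ : ∀ {n} → (Fin n → ℚ) → ℚ
∏ {zero}  f = 1ℚ
∏ {suc n} f = f zero * ∏ (λ i → f (suc i))

powℤ : (b : ℕ) → .{{NonZero b}} → ℤ → ℚ
powℤ b (+ k)      = (+ (b ℕ.^ k)) / 1
powℤ b (-[1+ k ]) = (+ 1) / (b ℕ.^ suc k)
  where instance _ = m^n≢0 b (suc k)

-- An n×n matrix whose entries are integer multiples of 1/2, represented by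
-- its doubled entries: the matrix γ with γ(i,j) = M i j / 2.
HalfMatrix : ℕ → Set
HalfMatrix n = Fin n → Fin n → ℕ

factorRatio : ℕ → ℚ
factorRatio k = (+ ((2 ∸ k) !)) / (k !)
  where instance _ = k !≢0

C-B2 : (n : ℕ) → HalfMatrix n → ℚ
C-B2 n γ =
  powℤ (2 !) {{2 !≢0}} ((+ (2 ℕ.* n)) ℤ.- (+ (n ℕ.* n)))
  * ∏ (λ i → ∏ (λ j → factorRatio (γ i j)))

P : ∀ {n} → Permutation′ n → Fin n → Fin n → ℕ
P σ i j = if does ((σ ⟨$⟩ʳ i) ≟ j) then 1 else 0

halfSum : ∀ {n} → Permutation′ n → Permutation′ n → HalfMatrix n
halfSum σ₁ σ₂ i j = P σ₁ i j ℕ.+ P σ₂ i j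

-- Each entry of ½(P σ₁ + P σ₂) doubled is k ∈ {0, 1, 2}, and for such k
-- (2 - k)!/k! = 2/2^k.  Every row of the doubled matrix sums to 2, so each row
-- contributes 2ⁿ/2² and the whole product is 2^(n²)/2^(2n), which the prefactor
-- 2^(2n - n²) cancels.
module Submission where

open import Defs
open import Data.Bool using (true; false; if_then_else_)
open import Data.Fin using (Fin; zero; suc)
open import Data.Fin.Permutation using (Permutation′; _⟨$⟩ʳ_)
open import Data.Fin.Properties using (_≟_)
open import Data.Integer as ℤ using (+_; _⊖_)
import Data.Integer.Properties as ℤ
open import Data.Nat as ℕ using (ℕ; zero; suc; NonZero; _^_; _≤_; _≥_; z≤n; s≤s)
import Data.Nat.Properties as ℕ
open import Algebra.Properties.CommutativeMonoid.Sum ℕ.+-0-commutativeMonoid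
  using (sum; ∑-distrib-+; sum-replicate-zero)
open import Data.Rational as ℚ using (ℚ; 1ℚ; _/_)
import Data.Rational.Properties as ℚ
import Data.Rational.Unnormalised as ℚᵘ
import Data.Rational.Unnormalised.Properties as ℚᵘ
open import Relation.Nullary.Decidable using (does)
open import Relation.Binary.PropositionalEquality
  using (_≡_; refl; sym; trans; cong; cong₂; module ≡-Reasoning)

/-distrib-* : ∀ i j m n .{{_ : NonZero m}} .{{_ : NonZero n}} →
              (i / m) ℚ.* (j / n) ≡ _/_ (i ℤ.* j) (m ℕ.* n) {{ℕ.m*n≢0 m n}}
/-distrib-* i j (suc m) (suc n) = ℚ.toℚᵘ-injective
  (ℚᵘ.≃-trans (ℚ.toℚᵘ-homo-* (ℚ.fromℚᵘ x) (ℚ.fromℚᵘ y))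
  (ℚᵘ.≃-trans (ℚᵘ.*-cong (ℚ.toℚᵘ-fromℚᵘ x) (ℚ.toℚᵘ-fromℚᵘ y))
              (ℚᵘ.≃-sym (ℚ.toℚᵘ-fromℚᵘ (x ℚᵘ.* y)))))
  where
  x y : ℚᵘ.ℚᵘ
  x = ℚᵘ.mkℚᵘ i m
  y = ℚᵘ.mkℚᵘ j n

/-cong-cross : ∀ i j m n .{{_ : NonZero m}} .{{_ : NonZero n}} →
               i ℤ.* + n ≡ j ℤ.* + m → i / m ≡ j / n
/-cong-cross i j (suc m) (suc n) eq = ℚ.fromℚᵘ-cong {ℚᵘ.mkℚᵘ i m} {ℚᵘ.mkℚᵘ j n} (ℚᵘ.*≡* eq)

module _ (b : ℕ) .{{_ : NonZero b}} where

  powRatio : ℕ → ℕ → ℚ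
  powRatio p q = + (b ^ p) / b ^ q
    where instance _ = ℕ.m^n≢0 b q

  powRatio-cong : ∀ {p q r s} → p ℕ.+ s ≡ r ℕ.+ q → powRatio p q ≡ powRatio r s
  powRatio-cong {p} {q} {r} {s} eq =
    /-cong-cross (+ (b ^ p)) (+ (b ^ r)) (b ^ q) (b ^ s) {{ℕ.m^n≢0 b q}} {{ℕ.m^n≢0 b s}} (begin
      + (b ^ p) ℤ.* + (b ^ s) ≡⟨ ℤ.pos-* (b ^ p) (b ^ s) ⟨
      + (b ^ p ℕ.* b ^ s)     ≡⟨ cong +_ (ℕ.^-distribˡ-+-* b p s) ⟨
      + (b ^ (p ℕ.+ s))       ≡⟨ cong (λ k → + (b ^ k)) eq ⟩
      + (b ^ (r ℕ.+ q))       ≡⟨ cong +_ (ℕ.^-distribˡ-+-* b r q) ⟩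
      + (b ^ r ℕ.* b ^ q)     ≡⟨ ℤ.pos-* (b ^ r) (b ^ q) ⟩
      + (b ^ r) ℤ.* + (b ^ q) ∎)
    where open ≡-Reasoning

  powRatio-* : ∀ p q p′ q′ → powRatio p q ℚ.* powRatio p′ q′ ≡ powRatio (p ℕ.+ p′) (q ℕ.+ q′)
  powRatio-* p q p′ q′ = trans
    (/-distrib-* (+ (b ^ p)) (+ (b ^ p′)) (b ^ q) (b ^ q′) {{ℕ.m^n≢0 b q}} {{ℕ.m^n≢0 b q′}})
    (ℚ./-cong {{ℕ.m*n≢0 (b ^ q) (b ^ q′) {{ℕ.m^n≢0 b q}} {{ℕ.m^n≢0 b q′}}}} {{ℕ.m^n≢0 b (q ℕ.+ q′)}}
      (trans (sym (ℤ.pos-* (b ^ p) (b ^ p′))) (cong +_ (sym (ℕ.^-distribˡ-+-* b p p′))))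
      (sym (ℕ.^-distribˡ-+-* b q q′)))

  powRatio-inverse : ∀ p q → powRatio p q ℚ.* powRatio q p ≡ 1ℚ
  powRatio-inverse p q = trans (powRatio-* p q q p)
    (powRatio-cong {p ℕ.+ q} {q ℕ.+ p} {0} {0} (trans (ℕ.+-identityʳ (p ℕ.+ q)) (ℕ.+-comm p q)))

  powℤ-⊖ : ∀ p q → powℤ b (p ⊖ q) ≡ powRatio p q
  powℤ-⊖ zero    zero    = refl
  powℤ-⊖ (suc p) zero    = refl
  powℤ-⊖ zero    (suc q) = refl
  powℤ-⊖ (suc p) (suc q) = begin
    powℤ b (suc p ⊖ suc q) ≡⟨ cong (powℤ b) (ℤ.[1+m]⊖[1+n]≡m⊖n p q) ⟩
    powℤ b (p ⊖ q)         ≡⟨ powℤ-⊖ p q ⟩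
    powRatio p q           ≡⟨ powRatio-cong {p} {q} {suc p} {suc q} (ℕ.+-suc p q) ⟩
    powRatio (suc p) (suc q) ∎
    where open ≡-Reasoning

  powℤ-difference : ∀ p q → powℤ b (+ p ℤ.- + q) ≡ powRatio p q
  powℤ-difference p q = trans (cong (powℤ b) (ℤ.m-n≡m⊖n p q)) (powℤ-⊖ p q)

  ∏-powRatio : ∀ {m} (p q : Fin m → ℕ) → ∏ (λ i → powRatio (p i) (q i)) ≡ powRatio (sum p) (sum q)
  ∏-powRatio {zero}  p q = refl
  ∏-powRatio {suc m} p q = trans
    (cong (powRatio (p zero) (q zero) ℚ.*_) (∏-powRatio (λ i → p (suc i)) (λ i → q (suc i))))
    (powRatio-* (p zero) (q zero) _ _)

∏-cong : ∀ {m} {f g : Fin m → ℚ} → (∀ i → f i ≡ g i) → ∏ f ≡ ∏ g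
∏-cong {zero}  eq = refl
∏-cong {suc m} eq = cong₂ ℚ._*_ (eq zero) (∏-cong (λ i → eq (suc i)))

sum-const : ∀ m k → sum {m} (λ _ → k) ≡ m ℕ.* k
sum-const zero    k = refl
sum-const (suc m) k = cong (k ℕ.+_) (sum-const m k)

factorRatio≡powRatio : ∀ {k} → k ≤ 2 → factorRatio k ≡ powRatio 2 1 k
factorRatio≡powRatio z≤n             = refl
factorRatio≡powRatio (s≤s z≤n)       = refl
factorRatio≡powRatio (s≤s (s≤s z≤n)) = refl

∏-factorRatio : ∀ {m} (k : Fin m → ℕ) → (∀ j → k j ≤ 2) →
                ∏ (λ j → factorRatio (k j)) ≡ powRatio 2 m (sum k)
∏-factorRatio {m} k k≤2 = begin
  ∏ (λ j → factorRatio (k j))            ≡⟨ ∏-cong (λ j → factorRatio≡powRatio (k≤2 j)) ⟩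
  ∏ (λ j → powRatio 2 1 (k j))           ≡⟨ ∏-powRatio 2 (λ _ → 1) k ⟩
  powRatio 2 (sum {m} (λ _ → 1)) (sum k) ≡⟨ cong (λ p → powRatio 2 p (sum k)) sum-ones ⟩
  powRatio 2 m (sum k)                   ∎
  where
  open ≡-Reasoning
  sum-ones : sum {m} (λ _ → 1) ≡ m
  sum-ones = trans (sum-const m 1) (ℕ.*-identityʳ m)

C-B2≡1 : ∀ n (γ : HalfMatrix n) → (∀ i j → γ i j ≤ 2) → (∀ i → sum (γ i) ≡ 2) → C-B2 n γ ≡ 1ℚ
C-B2≡1 n γ γ≤2 rows = begin
  C-B2 n γ
    ≡⟨ cong₂ ℚ._*_ (powℤ-difference 2 (2 ℕ.* n) (n ℕ.* n))
                   (∏-cong (λ i → trans (∏-factorRatio (γ i) (γ≤2 i)) (cong (powRatio 2 n) (rows i)))) ⟩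
  powRatio 2 (2 ℕ.* n) (n ℕ.* n) ℚ.* ∏ {n} (λ _ → powRatio 2 n 2)
    ≡⟨ cong (powRatio 2 (2 ℕ.* n) (n ℕ.* n) ℚ.*_) (∏-powRatio 2 {n} (λ _ → n) (λ _ → 2)) ⟩
  powRatio 2 (2 ℕ.* n) (n ℕ.* n) ℚ.* powRatio 2 (sum {n} (λ _ → n)) (sum {n} (λ _ → 2))
    ≡⟨ cong (powRatio 2 (2 ℕ.* n) (n ℕ.* n) ℚ.*_)
            (cong₂ (powRatio 2) (sum-const n n) (trans (sum-const n 2) (ℕ.*-comm n 2))) ⟩
  powRatio 2 (2 ℕ.* n) (n ℕ.* n) ℚ.* powRatio 2 (n ℕ.* n) (2 ℕ.* n)
    ≡⟨ powRatio-inverse 2 (2 ℕ.* n) (n ℕ.* n) ⟩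
  1ℚ ∎
  where open ≡-Reasoning

-- P σ i unfolds to indicator (σ ⟨$⟩ʳ i).
indicator : ∀ {m} → Fin m → Fin m → ℕ
indicator a j = if does (a ≟ j) then 1 else 0

indicator≤1 : ∀ {m} (a j : Fin m) → indicator a j ≤ 1
indicator≤1 a j with does (a ≟ j)
... | true  = s≤s z≤n
... | false = z≤n

sum-indicator : ∀ {m} (a : Fin m) → sum (indicator a) ≡ 1
sum-indicator {suc m} zero    = cong suc (sum-replicate-zero m)
sum-indicator {suc m} (suc a) = sum-indicator a

lemma39 : (n : ℕ) → n ≥ 1 → (σ₁ σ₂ : Permutation′ n) →
    C-B2 n (halfSum σ₁ σ₂) ≡ 1ℚ
lemma39 n _ σ₁ σ₂ = C-B2≡1 n (halfSum σ₁ σ₂) entry≤2 row-sum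
  where
  entry≤2 : ∀ i j → halfSum σ₁ σ₂ i j ≤ 2
  entry≤2 i j = ℕ.+-mono-≤ (indicator≤1 (σ₁ ⟨$⟩ʳ i) j) (indicator≤1 (σ₂ ⟨$⟩ʳ i) j)

  row-sum : ∀ i → sum (halfSum σ₁ σ₂ i) ≡ 2
  row-sum i = trans (∑-distrib-+ (P σ₁ i) (P σ₂ i))
                    (cong₂ ℕ._+_ (sum-indicator (σ₁ ⟨$⟩ʳ i)) (sum-indicator (σ₂ ⟨$⟩ʳ i)))
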